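{- Let $N$ be a network and $X\subseteq\Phi(N)$ any set of formulas, and let ${\cal P}_0$ be the protocol over $N$ constructed from $N$ and $X$ as described in the context. For any sets of channels $A,B\subseteq Ch(N)$, if $X\vdash_N A\rhd B$, then $A$ functionally determines $B$ with respect to ${\cal P}_0$.
   Context: A network $N$ is a finite undirected graph (loops and multiple edges allowed) whose vertices are parties and whose edges, called channels, are labeled by secret variables; $Ch(N)$ is the set of channels and $Inc(p)$ the set of channels incident with party $p$. A semi-protocol over $N$ assigns to each channel $c$ a set $V(c)$ of values and to each party $p$ a predicate $L_p$ on the values of the channels in $Inc(p)$; a run is a function $r$ with $r(c)\in V(c)$ for all $c$ satisfying all $L_p$; a protocol is a semi-protocol with at least one run. $A$ functionally determines $B$ w.r.t. a protocol if any two runs agreeing on all channels of $A$ agree on all channels of $B$. A path is a sequence of channels forming an undirected walk; $G$ is a gateway between $A$ and $B$ if every path starting in $A$ and ending in $B$ contains a channel of $G$. $\Phi(N)$ is the smallest set of formulas containing $A\rhd B$ for finite sets of channels $A,B$, the constant $\bot$, and closed under $\to$. The Logic of Secrets for $N$: propositional tautologies, Modus Ponens, and axioms Reflexivity ($A\rhd B$ if $A\supseteq B$), Augmentation ($A\rhd B\to A\cup C\rhd B\cup C$), Transitivity ($A\rhd B\to(B\rhd C\to A\rhd C)$), Gateway ($A\rhd B\to G\rhd B$ if $G$ is a gateway between $A$ and $B$ in $N$); $X\vdash_N\psi$ means derivability from $X$. For $E\subseteq Ch(N)$ let $E^*=\{c\in Ch(N): X\vdash_N E\rhd\{c\}\}$.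 Protocol ${\cal P}_0$: for each channel $c$, $V(c)$ is the set of functions $f:2^{Ch(N)}\to\{0,1\}$ such that $f(E)=0$ whenever $c\in E^*$; writing $r(c,E)$ for $r(c)(E)$, the local condition at party $p$ is: for all $E\subseteq Ch(N)$ and all $c,d\in Inc(p)\setminus E^*$, $r(c,E)=r(d,E)$. (The constant-zero assignment is a run, so ${\cal P}_0$ is a protocol.) -}

module Defs where

open import Data.Nat using (ℕ)
open import Data.Fin using (Fin)
open import Data.Fin.Subset using (Subset; _∈_; _⊆_; _∪_; ⁅_⁆)
open import Data.Bool using (Bool; true; false; if_then_else_)
open import Data.Product using (_×_; proj₁; proj₂; _,_; ∃)
open import Data.Sum using (_⊎_)
open import Data.List using (List; []; _∷_)
open import Data.List.Relation.Unary.Any using (Any)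
open import Relation.Binary.PropositionalEquality using (_≡_)
open import Relation.Nullary using (¬_)

-- A network: finitely many parties and finitely many channels (edges);
-- each channel has two (possibly equal: loops) endpoints; parallel
-- channels (multiple edges) are allowed since channels are distinct indices.
record Network : Set where
  field
    nParties  : ℕ
    nChannels : ℕ
    ends      : Fin nChannels → Fin nParties × Fin nParties

module _ (N : Network) where
  open Network N

  Party   = Fin nParties
  Channel = Fin nChannels
  ChSet   = Subset nChannels

  IncidentWith : Channel → Party → Set
  IncidentWith c p = (proj₁ (ends c) ≡ p) ⊎ (proj₂ (ends c) ≡ p)

  Joins : Channel → Party → Party → Set
  Joins c u v = (ends c ≡ (u , v)) ⊎ (ends c ≡ (v , u))

  data WalkFrom : Party → List Channel → Set where
    done : ∀ {v} → WalkFrom v []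
    step : ∀ {u v cs} (c : Channel) → Joins c u v → WalkFrom v cs → WalkFrom u (c ∷ cs)

  lastCh : Channel → List Channel → Channel
  lastCh c []        = c
  lastCh c (d ∷ cs)  = lastCh d cs

  IsPath : Channel → List Channel → Set
  IsPath c cs = ∃ λ v → WalkFrom v (c ∷ cs)

  Gateway : ChSet → ChSet → ChSet → Set
  Gateway G A B = ∀ (c : Channel) (cs : List Channel) → IsPath c cs →
                  c ∈ A → lastCh c cs ∈ B → Any (λ d → d ∈ G) (c ∷ cs)

  infixr 5 _⇒_
  infix 6 _▷_
  data Formula : Set where
    _▷_ : ChSet → ChSet → Formula
    ⊥f  : Formula
    _⇒_ : Formula → Formula → Formula

  eval : (ChSet → ChSet → Bool) → Formula → Bool
  eval v (A ▷ B) = v A B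
  eval v ⊥f      = false
  eval v (φ ⇒ ψ) = if eval v φ then eval v ψ else true

  -- propositional tautology (instance of a tautology over atoms A ▷ B)
  Tautology : Formula → Set
  Tautology φ = ∀ (v : ChSet → ChSet → Bool) → eval v φ ≡ true

  data _⊢_ (X : Formula → Set) : Formula → Set where
    hyp      : ∀ {φ} → X φ → X ⊢ φ
    taut     : ∀ {φ} → Tautology φ → X ⊢ φ
    mp       : ∀ {φ ψ} → X ⊢ φ → X ⊢ (φ ⇒ ψ) → X ⊢ ψ
    reflex   : ∀ {A B} → B ⊆ A → X ⊢ (A ▷ B)
    augment  : ∀ {A B C} → X ⊢ (A ▷ B ⇒ (A ∪ C) ▷ (B ∪ C))
    transit  : ∀ {A B C} → X ⊢ (A ▷ B ⇒ (B ▷ C ⇒ A ▷ C))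
    gateway  : ∀ {A B G} → Gateway G A B → X ⊢ (A ▷ B ⇒ G ▷ B)

  _∈Star_ : (X : Formula → Set) → Channel × ChSet → Set
  X ∈Star (c , E) = X ⊢ (E ▷ ⁅ c ⁆)

  -- Protocol P₀ built from N and X.
  -- Values of channel c: functions f : 2^{Ch(N)} → {0,1} (false = 0)
  -- with f E = 0 whenever c ∈ E*.
  ValueP₀ : (X : Formula → Set) → Channel → (ChSet → Bool) → Set
  ValueP₀ X c f = ∀ (E : ChSet) → X ∈Star (c , E) → f E ≡ false

  -- runs of P₀: r c E stands for r(c,E)
  RunP₀ : (X : Formula → Set) → (Channel → ChSet → Bool) → Set
  RunP₀ X r =
    (∀ c → ValueP₀ X c (r c)) ×
    (∀ (p : Party) (E : ChSet) (c d : Channel) →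
       IncidentWith c p → IncidentWith d p →
       ¬ (X ∈Star (c , E)) → ¬ (X ∈Star (d , E)) → r c E ≡ r d E)

  SameValue : (ChSet → Bool) → (ChSet → Bool) → Set
  SameValue f g = ∀ E → f E ≡ g E

  FunDetP₀ : (X : Formula → Set) → ChSet → ChSet → Set
  FunDetP₀ X A B =
    ∀ (r r' : Channel → ChSet → Bool) → RunP₀ X r → RunP₀ X r' →
      (∀ c → c ∈ A → SameValue (r c) (r' c)) →
      ∀ c → c ∈ B → SameValue (r c) (r' c)

-- Fix a network N, a set X of formulas, a derivable A ▷ B, two runs r, r'
-- of P₀ agreeing on A, a channel c ∈ B and a set E of channels; we show
-- r(c,E) = r'(c,E).  Classically, let G be the finite set E* of channels d
-- with X ⊢ E ▷ {d}.  Along a path avoiding E* the local conditions of P₀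
-- force r(·,E) to be constant, so if r(c,E) ≠ r'(c,E) then every path from
-- A to c meets G, i.e. G is a gateway between A and {c}.  The Gateway axiom
-- turns A ▷ {c} into G ▷ {c}; since E ▷ G (E derives each member of G), we
-- get E ▷ {c}, i.e. c ∈ E*, where every value of P₀ is 0 — a contradiction.
--
-- Constructively, membership in E* need not be decidable; but equality of
-- booleans is stable under double negation and, E* being a predicate on a
-- finite set, its decidability holds up to double negation.

module Submission where

open import Defs
open import Data.Nat using (zero; suc)
open import Data.Fin using (Fin; zero; suc)
open import Data.Fin.Subset using (Subset; _∈_; _∉_; _∪_; ⁅_⁆; ⋃)
open import Data.Fin.Subset.Properties
  using (⊆-reflexive; ∪-comm; ∪-idem; x∈p∪q⁺; x∈⁅x⁆; x∈⁅y⁆⇒x≡y; ∉⊥; _∈?_)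
open import Data.Bool using (Bool)
open import Data.Bool.Properties using () renaming (_≟_ to _≟ᴮ_)
open import Data.Product using (proj₁; proj₂; _,_)
open import Data.Sum using (inj₁; inj₂)
open import Data.List using (List; []; _∷_; map; filter; allFin)
import Data.List.Membership.Propositional as List
open import Data.List.Membership.Propositional.Properties using (∈-filter⁺; ∈-allFin)
open import Data.List.Relation.Unary.Any using (here; there; any?)
open import Data.List.Relation.Unary.All as All using (All; []; _∷_)
open import Data.List.Relation.Unary.All.Properties using (¬Any⇒All¬; all-filter)
open import Relation.Binary.PropositionalEquality using (_≡_; refl; sym; trans; cong; subst)
open import Relation.Nullary using (¬_; Dec; yes; no)
open import Relation.Nullary.Decidable using (decidable-stable; ¬¬-excluded-middle)
open import Data.Empty using (⊥-elim)

-- Decidability of a predicate on a finite set holds up to double negation;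
-- this is what makes the classical choice of the set E* harmless below.
¬¬-decidable : ∀ {n} (P : Fin n → Set) → ¬ ¬ (∀ i → Dec (P i))
¬¬-decidable {zero}  P k = k (λ ())
¬¬-decidable {suc n} P k =
  ¬¬-excluded-middle λ P₀? → ¬¬-decidable (λ i → P (suc i)) λ Pₛ? →
    k λ { zero → P₀? ; (suc i) → Pₛ? i }

∈-⋃-singletons : ∀ {n} {d : Fin n} (L : List (Fin n)) →
                 d List.∈ L → d ∈ ⋃ (map ⁅_⁆ L)
∈-⋃-singletons (d ∷ L) (here refl) = x∈p∪q⁺ (inj₁ (x∈⁅x⁆ d))
∈-⋃-singletons (_ ∷ L) (there d∈L) = x∈p∪q⁺ (inj₂ (∈-⋃-singletons L d∈L))

module _ (N : Network) (X : Formula N → Set) where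
  open Network N

  infix 4 ⊢_ _∈*_

  ⊢_ : Formula N → Set
  ⊢ φ = _⊢_ N X φ

  _∈*_ : Channel N → ChSet N → Set
  d ∈* E = _∈Star_ N X (d , E)

  ⊢-trans : ∀ {A B C} → ⊢ A ▷ B → ⊢ B ▷ C → ⊢ A ▷ C
  ⊢-trans A▷B B▷C = mp B▷C (mp A▷B transit)

  ⊢-augment : ∀ {A B} C → ⊢ A ▷ B → ⊢ (A ∪ C) ▷ (B ∪ C)
  ⊢-augment C A▷B = mp A▷B augment

  ⊢-≡ : ∀ {A B} → A ≡ B → ⊢ A ▷ B
  ⊢-≡ A≡B = reflex (⊆-reflexive (sym A≡B))

  -- Union rule: E ▷ B₁ and E ▷ B₂ give E ▷ B₁ ∪ B₂, via
  -- E = E ∪ E ▷ B₁ ∪ E = E ∪ B₁ ▷ B₂ ∪ B₁ = B₁ ∪ B₂.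
  ⊢-union : ∀ {E B₁ B₂} → ⊢ E ▷ B₁ → ⊢ E ▷ B₂ → ⊢ E ▷ (B₁ ∪ B₂)
  ⊢-union {E} {B₁} {B₂} E▷B₁ E▷B₂ =
    ⊢-trans (⊢-≡ (sym (∪-idem E)))
    (⊢-trans (⊢-augment E E▷B₁)
    (⊢-trans (⊢-≡ (∪-comm B₁ E))
    (⊢-trans (⊢-augment B₁ E▷B₂)
             (⊢-≡ (∪-comm B₂ B₁)))))

  ⊢-⋃ : ∀ {E} (L : List (Channel N)) →
        All (λ d → d ∈* E) L → ⊢ E ▷ ⋃ (map ⁅_⁆ L)
  ⊢-⋃ []      []         = reflex (λ x∈⊥ → ⊥-elim (∉⊥ x∈⊥))
  ⊢-⋃ (d ∷ L) (d∈* ∷ ds) = ⊢-union d∈* (⊢-⋃ L ds)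

  ⊢-member : ∀ {A B c} → ⊢ A ▷ B → c ∈ B → ⊢ A ▷ ⁅ c ⁆
  ⊢-member {c = c} A▷B c∈B =
    ⊢-trans A▷B (reflex λ x∈c → subst (_∈ _) (sym (x∈⁅y⁆⇒x≡y c x∈c)) c∈B)

  joins⇒incidentˡ : ∀ {c u v} → Joins N c u v → IncidentWith N c u
  joins⇒incidentˡ (inj₁ e) = inj₁ (cong proj₁ e)
  joins⇒incidentˡ (inj₂ e) = inj₂ (cong proj₂ e)

  joins⇒incidentʳ : ∀ {c u v} → Joins N c u v → IncidentWith N c v
  joins⇒incidentʳ (inj₁ e) = inj₂ (cong proj₂ e)
  joins⇒incidentʳ (inj₂ e) = inj₁ (cong proj₁ e)

  -- Along a walk avoiding E*, a run takes the same value at E on every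
  -- channel: consecutive channels share a party whose local condition
  -- equates them.
  constant-off-star : ∀ {r E v} → RunP₀ N X r → ∀ c cs → WalkFrom N v (c ∷ cs) →
                      All (λ d → ¬ d ∈* E) (c ∷ cs) → r c E ≡ r (lastCh N c cs) E
  constant-off-star run c []       _                       _ = refl
  constant-off-star {E = E} run c (d ∷ cs) (step _ j (step _ j′ w)) (c∉* ∷ d∉* ∷ off) =
    trans (proj₂ run _ E c d (joins⇒incidentʳ j) (joins⇒incidentˡ j′) c∉* d∉*)
          (constant-off-star run d cs (step d j′ w) (d∉* ∷ off))

  -- The core argument, assuming E* is decidable: G, the union of the
  -- members of E*, is derived from E and is a gateway between A and {c}
  -- unless r and r' already agree at (c, E).
  module _ {r r′ : Channel N → ChSet N → Bool} {A E : ChSet N}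
           (run : RunP₀ N X r) (run′ : RunP₀ N X r′)
           (agree : ∀ a → a ∈ A → r a E ≡ r′ a E)
           (_∈*?E : ∀ d → Dec (d ∈* E)) where

    starList : List (Channel N)
    starList = filter _∈*?E (allFin nChannels)

    G : ChSet N
    G = ⋃ (map ⁅_⁆ starList)

    E▷G : ⊢ E ▷ G
    E▷G = ⊢-⋃ starList (all-filter _∈*?E (allFin nChannels))

    off-G⇒off-star : ∀ d → d ∉ G → ¬ d ∈* E
    off-G⇒off-star d d∉G d∈* =
      d∉G (∈-⋃-singletons starList (∈-filter⁺ _∈*?E (∈-allFin d) d∈*))

    -- A path from A to c missing G transports agreement on A to c.
    G-gateway : ∀ c → ¬ r c E ≡ r′ c E → Gateway N G A ⁅ c ⁆
    G-gateway c disagree c₀ cs (_ , w) c₀∈A last∈c with any? (_∈? G) (c₀ ∷ cs)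
    ... | yes hits = hits
    ... | no misses = ⊥-elim (disagree (agree-along (x∈⁅y⁆⇒x≡y c last∈c)))
      where
        off : All (λ d → ¬ d ∈* E) (c₀ ∷ cs)
        off = All.map (λ {d} → off-G⇒off-star d) (¬Any⇒All¬ (c₀ ∷ cs) misses)
        agree-along : lastCh N c₀ cs ≡ c → r c E ≡ r′ c E
        agree-along refl =
          trans (sym (constant-off-star run c₀ cs w off))
                (trans (agree c₀ c₀∈A) (constant-off-star run′ c₀ cs w off))

    -- If A ▷ {c} then r, r' agree at (c, E): otherwise c ∈ E*, where both vanish.
    agree-at : ∀ c → ⊢ A ▷ ⁅ c ⁆ → r c E ≡ r′ c E
    agree-at c A▷c with r c E ≟ᴮ r′ c E
    ... | yes same = same
    ... | no disagree = trans (proj₁ run c E c∈*) (sym (proj₁ run′ c E c∈*))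
      where
        c∈* : c ∈* E
        c∈* = ⊢-trans E▷G (mp A▷c (gateway (G-gateway c disagree)))

theorem8 : (N : Network) (X : Formula N → Set)
           (A B : Subset (Network.nChannels N)) →
           _⊢_ N X (A ▷ B) → FunDetP₀ N X A B
theorem8 N X A B A▷B r r′ run run′ agree c c∈B E =
  decidable-stable (r c E ≟ᴮ r′ c E) λ disagree →
    ¬¬-decidable (λ d → _∈*_ N X d E) λ _∈*?E →
      disagree (agree-at N X run run′ (λ a a∈A → agree a a∈A E) _∈*?E c
                         (⊢-member N X A▷B c∈B))
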